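{- Let $k\ge 5$, let $\mathcal{C}$ be a $k$-dense family of cycles, and let $G$ be a $\mathcal{C}$-free graph with specified vertex $h$ which is $k$-fantastic. Then the circumference of $G$ is at most $k-1$.
   Context: $C_\ell$ is the cycle of length $\ell$; $\mathcal{C}$-free means containing no subgraph isomorphic to a member of $\mathcal{C}$; the circumference is the length of a longest cycle. For $k\geq5$, a family of cycles $\mathcal{C}$ is $k$-dense if: (1) $C_k,C_{k+1}\in\mathcal{C}$, except that when $k=5$ only $C_5\in\mathcal{C}$ is required; (2) $C_\ell\notin\mathcal{C}$ for all $\ell<k$; (3) for every $s\ge3$ there is $\ell$ with $s+2\le\ell\le3+(k-2)(s-2)$ and $C_\ell\in\mathcal{C}$. Let $G$ be a graph with specified vertex $h$; distances are in $G$. A block is a maximal subgraph that is a $K_2$ or $2$-connected. A block $B$ is rooted if some $r_B\in B$ is adjacent to all other vertices of $B$ and $d(r_B,h)<d(u,h)$ for all $u\in B\setminus\{r_B\}$ ($r_B$ is the root; it roots $B$). If $v\ne h$ roots every block containing it except exactly one block $B$, then $B$ is the stem $B_v$ of $v$. A vertex $v$ of a rooted block $B$ is finished in $B$ if $v$ is an endpoint of a path of length at least $k-3$ in $B-r_B$; $B$ is finished if all vertices of $B-r_B$ are finished; otherwise unfinished. $B$ is nearly $h$-dominated if $h\in B$ and all but one vertex of $B$ are adjacent to $h$ (then $r_B:=h$). Blocks $B_1,B_2$ form an $h$-umbrella if: $h$ is adjacent to all other vertices of $B_1$; $B_2$ is a $K_2$ block; $B_1\cap B_2=\{u\}$ with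 $u\ne h$; every other block meeting $B_1$ meets it at $h$; and the vertex of $B_2\setminus B_1$ (the handle) has degree $1$. It is finished if the unique neighbor of the handle is finished in $B_1$, else unfinished. $H$ is the subgraph induced by vertices in blocks that are nearly $h$-dominated or part of an unfinished $h$-umbrella ($H=\{h\}$ if none). $F$ is the subgraph induced by $h$ and all vertices of blocks of $G$ not contained in $H$. $G$ is $k$-fantastic if: (1) $F$ is connected; (2) every block in $F$ is rooted; (3) if $v\ne h$ roots some block in $F$, then $v$ is finished in its stem $B_v$; (4) each $v\ne h$ roots at most one unfinished block in $F$; (5) $h$ is adjacent to at most one vertex of degree $1$ in $F$. -}

module Defs where

open import Data.Nat using (ℕ; zero; suc; _+_; _*_; _∸_; _≤_; _<_)
open import Data.Fin using (Fin; toℕ; fromℕ; inject₁) renaming (zero to fzero; suc to fsuc)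
open import Data.Fin.Subset using (Subset; _∈_; _∉_; _⊆_; _-_; ∣_∣)
open import Data.Unit using (⊤)
open import Data.Bool using (Bool; true; false)
open import Data.Product using (Σ; ∃; ∃-syntax; _×_; _,_)
open import Data.Sum using (_⊎_)
open import Relation.Nullary using (¬_)
open import Relation.Binary.PropositionalEquality using (_≡_; _≢_)
open import Function.Definitions using (Injective)

record Graph : Set where
  field
    n    : ℕ
    E    : Fin n → Fin n → Bool
    symE : ∀ u v → E u v ≡ E v u
    irrE : ∀ u → E u u ≡ false

Vertex : Graph → Set
Vertex G = Fin (Graph.n G)

Adj : (G : Graph) → Vertex G → Vertex G → Set
Adj G u v = Graph.E G u v ≡ true

HasCycle : Graph → ℕ → Set
HasCycle G ℓ =
  Σ (Fin ℓ → Vertex G) λ c →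
    3 ≤ ℓ × Injective _≡_ _≡_ c ×
    (∀ i j → (suc (toℕ i) ≡ toℕ j ⊎ (suc (toℕ i) ≡ ℓ × toℕ j ≡ 0)) → Adj G (c i) (c j))

-- A family of cycles is given by the set of lengths ℓ with C_ℓ ∈ 𝒞.
CycleFamily : Set₁
CycleFamily = ℕ → Set

CFree : Graph → CycleFamily → Set
CFree G 𝒞 = ∀ ℓ → 𝒞 ℓ → ¬ HasCycle G ℓ

CircumferenceAtMost : Graph → ℕ → Set
CircumferenceAtMost G m = ∀ ℓ → HasCycle G ℓ → ℓ ≤ m

KDense : ℕ → CycleFamily → Set
KDense k 𝒞 =
  (𝒞 k × (¬ (k ≡ 5) → 𝒞 (suc k))) ×
  (∀ ℓ → ℓ < k → ¬ 𝒞 ℓ) ×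
  (∀ s → 3 ≤ s → ∃[ ℓ ] (s + 2 ≤ ℓ × ℓ ≤ 3 + (k ∸ 2) * (s ∸ 2) × 𝒞 ℓ))

module _ (G : Graph) where

  private V = Vertex G

  WalkIn : (V → Set) → V → V → ℕ → Set
  WalkIn P u v m =
    Σ (Fin (suc m) → V) λ f →
      f fzero ≡ u × f (fromℕ m) ≡ v ×
      (∀ (i : Fin m) → Adj G (f (inject₁ i)) (f (fsuc i))) ×
      (∀ i → P (f i))

  PathIn : (V → Set) → V → V → ℕ → Set
  PathIn P u v m =
    Σ (Fin (suc m) → V) λ f →
      f fzero ≡ u × f (fromℕ m) ≡ v ×
      (∀ (i : Fin m) → Adj G (f (inject₁ i)) (f (fsuc i))) ×
      (∀ i → P (f i)) × Injective _≡_ _≡_ f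

  Everywhere : V → Set
  Everywhere _ = ⊤

  Dist : V → V → ℕ → Set
  Dist u v d = WalkIn Everywhere u v d × (∀ m → WalkIn Everywhere u v m → d ≤ m)

  -- d(a,h) < d(b,h), distances in ℕ ∪ {∞} (an unreachable vertex has distance ∞)
  DistLess : V → V → V → Set
  DistLess h a b = ∃[ da ] (Dist a h da × (∀ db → Dist b h db → da < db))

  ConnectedIn : (V → Set) → Set
  ConnectedIn P = ∀ u v → P u → P v → ∃[ m ] WalkIn P u v m

  -- degree of u in the subgraph induced by P is exactly 1 (u assumed in P)
  Degree1In : (V → Set) → V → Set
  Degree1In P u = ∃[ x ] (P x × Adj G u x × (∀ y → P y → Adj G u y → y ≡ x))

  -- Blocks of the induced subgraph G[A].  Maximal 2-connected subgraphs
  -- (and K2 blocks) are induced, so a block is given by its vertex set.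

  IsK2 : Subset (Graph.n G) → Set
  IsK2 B = ∃[ u ] ∃[ v ] (u ≢ v × Adj G u v × (∀ x → x ∈ B → x ≡ u ⊎ x ≡ v) × u ∈ B × v ∈ B)

  Is2Connected : Subset (Graph.n G) → Set
  Is2Connected B = 3 ≤ ∣ B ∣ × ConnectedIn (_∈ B) × (∀ x → x ∈ B → ConnectedIn (_∈ (B - x)))

  K2or2Conn : Subset (Graph.n G) → Set
  K2or2Conn B = IsK2 B ⊎ Is2Connected B

  IsBlockIn : (V → Set) → Subset (Graph.n G) → Set
  IsBlockIn A B =
    (∀ x → x ∈ B → A x) × K2or2Conn B ×
    (∀ B' → B ⊆ B' → (∀ x → x ∈ B' → A x) → K2or2Conn B' → B' ≡ B)

  IsBlock : Subset (Graph.n G) → Set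
  IsBlock = IsBlockIn Everywhere

  module _ (k : ℕ) (h : V) where

    Roots : Subset (Graph.n G) → V → Set
    Roots B r = r ∈ B × (∀ u → u ∈ B → u ≢ r → Adj G r u) × (∀ u → u ∈ B → u ≢ r → DistLess h r u)

    Rooted : Subset (Graph.n G) → Set
    Rooted B = ∃[ r ] Roots B r

    IsStemIn : (V → Set) → V → Subset (Graph.n G) → Set
    IsStemIn A v B =
      v ≢ h × IsBlockIn A B × v ∈ B × ¬ Roots B v ×
      (∀ B' → IsBlockIn A B' → v ∈ B' → B' ≢ B → Roots B' v)

    FinishedIn : Subset (Graph.n G) → V → Set
    FinishedIn B v = ∃[ r ] (Roots B r × ∃[ w ] ∃[ m ] (k ∸ 3 ≤ m × PathIn (_∈ (B - r)) v w m))

    FinishedBlock : Subset (Graph.n G) → Set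
    FinishedBlock B = ∃[ r ] (Roots B r × (∀ v → v ∈ B → v ≢ r → FinishedIn B v))

    NearlyDominated : Subset (Graph.n G) → Set
    NearlyDominated B =
      IsBlock B × h ∈ B ×
      ∃[ u ] (u ∈ B × u ≢ h × ¬ Adj G h u × (∀ w → w ∈ B → w ≢ h → ¬ Adj G h w → w ≡ u))

    Umbrella : Subset (Graph.n G) → Subset (Graph.n G) → V → Set
    Umbrella B1 B2 u =
      IsBlock B1 × IsBlock B2 × h ∈ B1 ×
      (∀ w → w ∈ B1 → w ≢ h → Adj G h w) ×
      IsK2 B2 ×
      u ≢ h × u ∈ B1 × u ∈ B2 × (∀ x → x ∈ B1 → x ∈ B2 → x ≡ u) ×
      (∀ B → IsBlock B → B ≢ B1 → B ≢ B2 → ∀ x → x ∈ B → x ∈ B1 → x ≡ h) ×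
      (∀ w → w ∈ B2 → w ∉ B1 → Degree1In Everywhere w)

    UnfinishedUmbrella : Subset (Graph.n G) → Subset (Graph.n G) → Set
    UnfinishedUmbrella B1 B2 = ∃[ u ] (Umbrella B1 B2 u × ¬ FinishedIn B1 u)

    InH : V → Set
    InH x = x ≡ h ⊎
      ∃[ B ] (x ∈ B × (NearlyDominated B ⊎ ∃[ B' ] (UnfinishedUmbrella B B' ⊎ UnfinishedUmbrella B' B)))

    InF : V → Set
    InF x = x ≡ h ⊎ ∃[ B ] (IsBlock B × x ∈ B × ¬ (∀ y → y ∈ B → InH y))

    Fantastic : Set
    Fantastic =
      ConnectedIn InF ×
      (∀ B → IsBlockIn InF B → Rooted B) ×
      (∀ v B → v ≢ h → IsBlockIn InF B → Roots B v →
         ∃[ Bv ] (IsStemIn InF v Bv × FinishedIn Bv v)) ×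
      (∀ v B1 B2 → v ≢ h → IsBlockIn InF B1 → IsBlockIn InF B2 →
         Roots B1 v → Roots B2 v → ¬ FinishedBlock B1 → ¬ FinishedBlock B2 → B1 ≡ B2) ×
      (∀ u1 u2 → InF u1 → InF u2 → Adj G h u1 → Adj G h u2 →
         Degree1In InF u1 → Degree1In InF u2 → u1 ≡ u2)

-- A cycle of length ℓ ≥ k spans a
-- 2-connected set, hence lies in a block B of G.  If B is a block of F, its root r is adjacent to
-- every other vertex of B.  Otherwise B lies in H; two consecutive cycle vertices x, y ≠ h then lie in
-- blocks through h that h dominates up to one vertex u, and gluing blocks along shared vertices
-- shows that B lies inside the block of x.
-- Either way some vertex r is adjacent to all cycle vertices except r and u, and r together with
-- k − 1 consecutive cycle vertices avoiding r and with ends other than u closes a C_k, which 𝒞 forbids.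
module Submission where

open import Defs
open import Data.Nat using (ℕ; zero; suc; _+_; _∸_; _≤_; _<_; z≤n; s≤s; z<s; _≤?_; _<?_; _%_; NonZero)
open import Data.Nat.Properties
open import Data.Nat.DivMod using (%-distribˡ-+; m%n%n≡m%n; [m+n]%n≡m%n; m<n⇒m%n≡m; n%n≡0; m%n<n)
open import Data.Fin using (Fin; toℕ; fromℕ<; inject₁) renaming (zero to fzero; suc to fsuc)
open import Data.Fin.Properties using (toℕ-fromℕ<; toℕ-injective; toℕ<n; any?) renaming (_≟_ to _≟F_)
open import Data.Fin.Subset using (Subset; inside; outside; _∈_; _∉_; _⊆_; _⊂_; _─_; _-_; _∪_; ⁅_⁆; ∣_∣)
open import Data.Fin.Subset.Properties
  using (_∈?_; x∈⁅x⁆; p─q⊆p; x∈p∧x≢y⇒x∈p-y; x∈p⇒∣p-x∣<∣p∣; p⊂q⇒∣p∣<∣q∣; ∣p∣≤n; ⊆-refl; ⊆-antisym; p⊆p∪q; q⊆p∪q; x∈p∪q⁻)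
open import Data.Vec using (_∷_; tabulate)
open import Data.Vec.Base using (there)
open import Data.Vec.Properties using (lookup∘tabulate; []=⇒lookup; lookup⇒[]=)
open import Data.Bool using (true) renaming (_≟_ to _≟B_)
open import Data.Product using (∃-syntax; _×_; _,_; proj₁; proj₂)
open import Data.Sum using (_⊎_; inj₁; inj₂)
import Data.Sum as Sum
open import Data.Unit using (tt)
open import Data.Empty using (⊥)
open import Function using (_∘_; id)
open import Relation.Nullary using (¬_; Dec; yes; no; does; contradiction)
open import Relation.Binary using (tri<; tri≈; tri>)
open import Relation.Nullary.Decidable using (dec-true; map′; decidable-stable)
open import Relation.Nullary.Decidable.Core using (¬¬-excluded-middle)
open import Relation.Binary.PropositionalEquality hiding ([_])

[m+n]%d≡[m+n%d]%d : ∀ m n d .{{_ : NonZero d}} → (m + n) % d ≡ (m + n % d) % d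
[m+n]%d≡[m+n%d]%d m n d = begin
  (m + n) % d             ≡⟨ %-distribˡ-+ m n d ⟩
  (m % d + n % d) % d     ≡⟨ cong (λ x → (m % d + x) % d) (sym (m%n%n≡m%n n d)) ⟩
  (m % d + n % d % d) % d ≡⟨ sym (%-distribˡ-+ m (n % d) d) ⟩
  (m + n % d) % d         ∎
  where open ≡-Reasoning

[1+m]%n≡1+[m%n]⊎1+[m%n]≡n : ∀ m n .{{_ : NonZero n}} → suc (m % n) ≡ suc m % n ⊎ (suc (m % n) ≡ n × suc m % n ≡ 0)
[1+m]%n≡1+[m%n]⊎1+[m%n]≡n m n with m≤n⇒m<n∨m≡n (m%n<n m n)
... | inj₁ 1+r<n = inj₁ (sym (trans ([m+n]%d≡[m+n%d]%d 1 m n) (m<n⇒m%n≡m 1+r<n)))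
... | inj₂ 1+r≡n = inj₂ (1+r≡n , trans ([m+n]%d≡[m+n%d]%d 1 m n) (trans (cong (_% n) 1+r≡n) (n%n≡0 n)))

[d+i]%n≢i%n : ∀ d i n .{{_ : NonZero n}} → 0 < d → d < n → (d + i) % n ≢ i % n
[d+i]%n≢i%n d@(suc d′) i n _ d<n eq with d + i % n <? n
... | yes d+r<n = m≢1+n+m (i % n) (sym (trans (sym (m<n⇒m%n≡m d+r<n)) eq′))
  where eq′ = trans (sym ([m+n]%d≡[m+n%d]%d d i n)) eq
... | no d+r≮n = <⇒≢ d<n (+-cancelʳ-≡ r d n d+r≡n+r)
  where
    r = i % n
    n≤d+r = ≮⇒≥ d+r≮n
    e = d + r ∸ n
    e<n : e < n
    e<n = subst (e <_) (m+n∸n≡m n n) (∸-monoˡ-< (+-mono-< d<n (m%n<n i n)) n≤d+r)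
    e≡r : e ≡ r
    e≡r = begin
      e                ≡⟨ sym (m<n⇒m%n≡m e<n) ⟩
      e % n            ≡⟨ sym ([m+n]%n≡m%n e n) ⟩
      (e + n) % n      ≡⟨ cong (_% n) (m∸n+n≡m n≤d+r) ⟩
      (d + r) % n      ≡⟨ sym ([m+n]%d≡[m+n%d]%d d i n) ⟩
      (d + i) % n      ≡⟨ eq ⟩
      r                ∎
      where open ≡-Reasoning
    d+r≡n+r : d + r ≡ n + r
    d+r≡n+r = trans (sym (m∸n+n≡m n≤d+r)) (trans (cong (_+ n) e≡r) (+-comm r n))

x∈p─q⇒x∉q : ∀ {n} {p q : Subset n} {x} → x ∈ p ─ q → x ∉ q
x∈p─q⇒x∉q {p = _ ∷ _} {inside  ∷ _} {fzero} () _
x∈p─q⇒x∉q {p = _ ∷ _} {outside ∷ _} {fzero} _ ()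
x∈p─q⇒x∉q {p = _ ∷ _} {_ ∷ _} {fsuc x} (there x∈p─q) (there x∈q) = x∈p─q⇒x∉q x∈p─q x∈q

module _ {n : ℕ} where

  x∈p-y⇒x∈p : ∀ {p : Subset n} {x y} → x ∈ p - y → x ∈ p
  x∈p-y⇒x∈p {p} {y = y} = p─q⊆p p ⁅ y ⁆

  x∈p-y⇒x≢y : ∀ {p : Subset n} {x y} → x ∈ p - y → x ≢ y
  x∈p-y⇒x≢y x∈p-y refl = x∈p─q⇒x∉q x∈p-y (x∈⁅x⁆ _)

  distinct₃⇒3≤∣p∣ : ∀ {p : Subset n} {a b c} → a ∈ p → b ∈ p → c ∈ p → a ≢ b → a ≢ c → b ≢ c → 3 ≤ ∣ p ∣
  distinct₃⇒3≤∣p∣ a∈p b∈p c∈p a≢b a≢c b≢c = ≤-trans (s≤s (≤-trans (s≤s (≤-trans z<s c<)) b<)) a<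
    where
      a< = x∈p⇒∣p-x∣<∣p∣ a∈p
      b< = x∈p⇒∣p-x∣<∣p∣ (x∈p∧x≢y⇒x∈p-y b∈p (a≢b ∘ sym))
      c< = x∈p⇒∣p-x∣<∣p∣ (x∈p∧x≢y⇒x∈p-y (x∈p∧x≢y⇒x∈p-y c∈p (a≢c ∘ sym)) (b≢c ∘ sym))

  toSubset : {P : Fin n → Set} → (∀ x → Dec (P x)) → Subset n
  toSubset P? = tabulate (does ∘ P?)

  ∈-toSubset⁺ : ∀ {P : Fin n → Set} (P? : ∀ x → Dec (P x)) {x} → P x → x ∈ toSubset P?
  ∈-toSubset⁺ P? {x} px = lookup⇒[]= x (toSubset P?) (trans (lookup∘tabulate _ x) (dec-true (P? x) px))

  ∈-toSubset⁻ : ∀ {P : Fin n → Set} (P? : ∀ x → Dec (P x)) {x} → x ∈ toSubset P? → P x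
  ∈-toSubset⁻ P? {x} x∈ with P? x | trans (sym (lookup∘tabulate (does ∘ P?) x)) ([]=⇒lookup x∈)
  ... | yes px | _ = px
  ... | no _   | ()

  module _ (Good : Subset n → Set) where

    Maximal : Subset n → Set
    Maximal B = Good B × (∀ B′ → B ⊆ B′ → Good B′ → B′ ≡ B)

    ¬¬-maximal-extension : ∀ S → Good S → ¬ ¬ (∃[ B ] (S ⊆ B × Maximal B))
    ¬¬-maximal-extension S = extend n S (m≤n+m n ∣ S ∣)
      where
        extend : ∀ fuel S → n ≤ ∣ S ∣ + fuel → Good S → ¬ ¬ (∃[ B ] (S ⊆ B × Maximal B))
        extend fuel S bound gS noMax = ¬¬-excluded-middle λ
          { (no noLarger) → noMax (S , ⊆-refl , gS , λ B′ S⊆B′ gB′ → ⊆-antisym (B′⊆S noLarger S⊆B′ gB′) S⊆B′)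
          ; (yes (B , S⊂B , gB)) → grow fuel bound B S⊂B gB noMax }
          where
            B′⊆S : ¬ (∃[ B ] (S ⊂ B × Good B)) → ∀ {B′} → S ⊆ B′ → Good B′ → B′ ⊆ S
            B′⊆S noLarger {B′} S⊆B′ gB′ {x} x∈B′ with x ∈? S
            ... | yes x∈S = x∈S
            ... | no x∉S = contradiction (B′ , ((λ {y} → S⊆B′ {y}) , x , x∈B′ , x∉S) , gB′) noLarger
            grow : ∀ fuel → n ≤ ∣ S ∣ + fuel → ∀ B → S ⊂ B → Good B → ¬ ¬ (∃[ B′ ] (S ⊆ B′ × Maximal B′))
            grow zero bound B S⊂B _ _ =
              <⇒≱ (<-≤-trans (p⊂q⇒∣p∣<∣q∣ S⊂B) (∣p∣≤n B)) (subst (n ≤_) (+-identityʳ _) bound)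
            grow (suc fuel) bound B S⊂B gB noMax =
              extend fuel B (≤-trans bound (subst (_≤ ∣ B ∣ + fuel) (sym (+-suc ∣ S ∣ fuel)) (+-monoˡ-≤ fuel (p⊂q⇒∣p∣<∣q∣ S⊂B)))) gB
                λ (B′ , B⊆B′ , maxB′) → noMax (B′ , B⊆B′ ∘ proj₁ S⊂B , maxB′)

module _ (G : Graph) where
  private
    V = Vertex G
    N = Graph.n G

  Adj-sym : ∀ {u v} → Adj G u v → Adj G v u
  Adj-sym {u} {v} = trans (Graph.symE G v u)

  Adj⇒≢ : ∀ {u v} → Adj G u v → u ≢ v
  Adj⇒≢ {u} uv refl with () ← trans (sym uv) (Graph.irrE G u)

  infixr 5 _∷⟨_⟩_
  data Walk (P : V → Set) : V → V → Set where
    [_]    : ∀ {u} → P u → Walk P u u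
    _∷⟨_⟩_ : ∀ {u w v} → P u → Adj G u w → Walk P w v → Walk P u v

  module _ {P : V → Set} where

    length : ∀ {u v} → Walk P u v → ℕ
    length [ _ ] = 0
    length (_ ∷⟨ _ ⟩ w) = suc (length w)

    toWalkIn : ∀ {u v} (w : Walk P u v) → WalkIn G P u v (length w)
    toWalkIn [ pu ] = (λ _ → _) , refl , refl , (λ ()) , λ _ → pu
    toWalkIn (_∷⟨_⟩_ {u} pu u~w w) with toWalkIn w
    ... | f , f-start , f-end , f-adj , f-in = f′ , refl , f-end , f′-adj , f′-in
      where
        f′ : Fin (suc (suc (length w))) → V
        f′ fzero = u
        f′ (fsuc i) = f i
        f′-adj : ∀ i → Adj G (f′ (inject₁ i)) (f′ (fsuc i))
        f′-adj fzero = subst (Adj G u) (sym f-start) u~w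
        f′-adj (fsuc i) = f-adj i
        f′-in : ∀ i → P (f′ i)
        f′-in fzero = pu
        f′-in (fsuc i) = f-in i

    fromWalkIn : ∀ m {u v} → WalkIn G P u v m → Walk P u v
    fromWalkIn zero (f , refl , refl , _ , f-in) = [ f-in fzero ]
    fromWalkIn (suc m) (f , refl , f-end , f-adj , f-in) =
      f-in fzero ∷⟨ f-adj fzero ⟩ fromWalkIn m ((f ∘ fsuc) , refl , f-end , f-adj ∘ fsuc , f-in ∘ fsuc)

    infixr 5 _++_
    _++_ : ∀ {u v w} → Walk P u v → Walk P v w → Walk P u w
    [ _ ] ++ w′ = w′
    (pu ∷⟨ a ⟩ w) ++ w′ = pu ∷⟨ a ⟩ (w ++ w′)

    head : ∀ {u v} → Walk P u v → P u
    head [ pu ] = pu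
    head (pu ∷⟨ _ ⟩ _) = pu

    reverse : ∀ {u v} → Walk P u v → Walk P v u
    reverse [ pu ] = [ pu ]
    reverse (pu ∷⟨ a ⟩ w) = reverse w ++ (head w ∷⟨ Adj-sym a ⟩ [ pu ])

  map : ∀ {P Q : V → Set} {u v} → (∀ {x} → P x → Q x) → Walk P u v → Walk Q u v
  map f [ pu ] = [ f pu ]
  map f (pu ∷⟨ a ⟩ w) = f pu ∷⟨ a ⟩ map f w

  module _ {P : V → Set} where

    walk : ConnectedIn G P → ∀ {u v} → P u → P v → Walk P u v
    walk conn pu pv = fromWalkIn _ (proj₂ (conn _ _ pu pv))

    connected-via : ∀ b → P b → (∀ v → P v → Walk P v b) → ConnectedIn G P
    connected-via b pb to-b u v pu pv = _ , toWalkIn (to-b u pu ++ reverse (to-b v pv))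

    star-connected : ∀ b → P b → (∀ x → P x → x ≡ b ⊎ Adj G x b) → ConnectedIn G P
    star-connected b pb near = connected-via b pb to-b
      where
        to-b : ∀ v → P v → Walk P v b
        to-b v pv with near v pv
        ... | inj₁ refl = [ pv ]
        ... | inj₂ v~b = pv ∷⟨ v~b ⟩ [ pb ]

  connected-resp : ∀ {P Q : V → Set} → (∀ {x} → P x → Q x) → (∀ {x} → Q x → P x) → ConnectedIn G P → ConnectedIn G Q
  connected-resp P⇒Q Q⇒P conn u v qu qv = _ , toWalkIn (map P⇒Q (walk conn (Q⇒P qu) (Q⇒P qv)))

  Linked : (V → Set) → (V → Set) → Set
  Linked P Q = (∃[ a ] (P a × Q a)) ⊎ (∃[ x ] ∃[ y ] (P x × Q y × Adj G x y))

  connected-∪ : ∀ {P Q R : V → Set} → ConnectedIn G P → ConnectedIn G Q → Linked P Q →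
    (∀ {x} → P x → R x) → (∀ {x} → Q x → R x) → (∀ {x} → R x → P x ⊎ Q x) → ConnectedIn G R
  connected-∪ {P} {Q} {R} cP cQ (inj₁ (a , pa , qa)) P⇒R Q⇒R R⇒P⊎Q = connected-via a (P⇒R pa) to-a
    where
      to-a : ∀ v → R v → Walk R v a
      to-a v rv = Sum.[ (λ pv → map P⇒R (walk cP pv pa)) , (λ qv → map Q⇒R (walk cQ qv qa)) ] (R⇒P⊎Q rv)
  connected-∪ {P} {Q} {R} cP cQ (inj₂ (x , y , px , qy , x~y)) P⇒R Q⇒R R⇒P⊎Q = connected-via x (P⇒R px) to-x
    where
      to-x : ∀ v → R v → Walk R v x
      to-x v rv = Sum.[ (λ pv → map P⇒R (walk cP pv px))
                  , (λ qv → map Q⇒R (walk cQ qv qy) ++ (Q⇒R qy ∷⟨ Adj-sym x~y ⟩ [ P⇒R px ])) ] (R⇒P⊎Q rv)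

  TwoConnected : Subset N → Set
  TwoConnected X = ConnectedIn G (_∈ X) × (∀ z → z ∈ X → ConnectedIn G (_∈ X - z))

  TwoConnected-minus : ∀ {X} → TwoConnected X → ∀ z → ConnectedIn G (_∈ X - z)
  TwoConnected-minus {X} (conn , conn-minus) z with z ∈? X
  ... | yes z∈X = conn-minus z z∈X
  ... | no z∉X = connected-resp (λ x∈X → x∈p∧x≢y⇒x∈p-y x∈X λ { refl → z∉X x∈X }) x∈p-y⇒x∈p conn

  K2or2Conn⇒TwoConnected : ∀ {B} → K2or2Conn G B → TwoConnected B
  K2or2Conn⇒TwoConnected (inj₂ (_ , conn , conn-minus)) = conn , conn-minus
  K2or2Conn⇒TwoConnected {B} (inj₁ (u , v , u≢v , u~v , only-uv , u∈B , v∈B)) =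
    star-connected u u∈B (λ x x∈B → toward-u (only-uv x x∈B)) , minus
    where
      toward-u : ∀ {x} → x ≡ u ⊎ x ≡ v → x ≡ u ⊎ Adj G x u
      toward-u = Sum.map id λ { refl → Adj-sym u~v }
      minus : ∀ z → z ∈ B → ConnectedIn G (_∈ B - z)
      minus z _ with u ≟F z
      ... | yes refl = star-connected v (x∈p∧x≢y⇒x∈p-y v∈B (u≢v ∘ sym))
              λ x x∈B-u → inj₁ (Sum.[ (λ x≡u → contradiction x≡u (x∈p-y⇒x≢y x∈B-u)) , (λ x≡v → x≡v) ]
                                   (only-uv x (x∈p-y⇒x∈p x∈B-u)))
      ... | no u≢z = star-connected u (x∈p∧x≢y⇒x∈p-y u∈B u≢z) λ x x∈B-z → toward-u (only-uv x (x∈p-y⇒x∈p x∈B-z))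

  ∪-TwoConnected : ∀ {X Y} → TwoConnected X → TwoConnected Y →
    Linked (_∈ X) (_∈ Y) → (∀ z → Linked (_∈ X - z) (_∈ Y - z)) → TwoConnected (X ∪ Y)
  ∪-TwoConnected {X} {Y} cX cY linked linked-minus =
    connected-∪ (proj₁ cX) (proj₁ cY) linked (p⊆p∪q Y) (q⊆p∪q X Y) (x∈p∪q⁻ X Y) ,
    λ z _ → connected-∪ (TwoConnected-minus cX z) (TwoConnected-minus cY z) (linked-minus z)
      (λ x∈X-z → x∈p∧x≢y⇒x∈p-y (p⊆p∪q Y (x∈p-y⇒x∈p x∈X-z)) (x∈p-y⇒x≢y x∈X-z))
      (λ x∈Y-z → x∈p∧x≢y⇒x∈p-y (q⊆p∪q X Y (x∈p-y⇒x∈p x∈Y-z)) (x∈p-y⇒x≢y x∈Y-z))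
      (λ x∈∪-z → Sum.map (λ x∈X → x∈p∧x≢y⇒x∈p-y x∈X (x∈p-y⇒x≢y x∈∪-z)) (λ x∈Y → x∈p∧x≢y⇒x∈p-y x∈Y (x∈p-y⇒x≢y x∈∪-z))
                          (x∈p∪q⁻ X Y (x∈p-y⇒x∈p x∈∪-z)))

  ∪-TwoConnected-sharing₂ : ∀ {X Y a b} → TwoConnected X → TwoConnected Y → a ≢ b →
    a ∈ X → a ∈ Y → b ∈ X → b ∈ Y → TwoConnected (X ∪ Y)
  ∪-TwoConnected-sharing₂ {a = a} {b} cX cY a≢b a∈X a∈Y b∈X b∈Y = ∪-TwoConnected cX cY (inj₁ (a , a∈X , a∈Y)) linked
    where
      linked : ∀ z → Linked _ _
      linked z with a ≟F z
      ... | yes refl = inj₁ (b , x∈p∧x≢y⇒x∈p-y b∈X (a≢b ∘ sym) , x∈p∧x≢y⇒x∈p-y b∈Y (a≢b ∘ sym))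
      ... | no a≢z = inj₁ (a , x∈p∧x≢y⇒x∈p-y a∈X a≢z , x∈p∧x≢y⇒x∈p-y a∈Y a≢z)

  ∪-TwoConnected-sharing-edge : ∀ {X Y a x y} → TwoConnected X → TwoConnected Y →
    a ∈ X → a ∈ Y → x ∈ X → y ∈ Y → Adj G x y → x ≢ a → y ≢ a → TwoConnected (X ∪ Y)
  ∪-TwoConnected-sharing-edge {a = a} {x} {y} cX cY a∈X a∈Y x∈X y∈Y x~y x≢a y≢a =
    ∪-TwoConnected cX cY (inj₁ (a , a∈X , a∈Y)) linked
    where
      linked : ∀ z → Linked _ _
      linked z with a ≟F z
      ... | yes refl = inj₂ (x , y , x∈p∧x≢y⇒x∈p-y x∈X x≢a , x∈p∧x≢y⇒x∈p-y y∈Y y≢a , x~y)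
      ... | no a≢z = inj₁ (a , x∈p∧x≢y⇒x∈p-y a∈X a≢z , x∈p∧x≢y⇒x∈p-y a∈Y a≢z)

  ¬¬-block-containing : ∀ {A : V → Set} S → (∀ x → x ∈ S → A x) → K2or2Conn G S →
    ¬ ¬ (∃[ B ] (S ⊆ B × IsBlockIn G A B))
  ¬¬-block-containing {A} S S⊆A S-k2c noBlock =
    ¬¬-maximal-extension Good S (S⊆A , S-k2c) λ (B , S⊆B , (B⊆A , B-k2c) , maximal) →
      noBlock (B , S⊆B , B⊆A , B-k2c , λ B′ B⊆B′ B′⊆A B′-k2c → maximal B′ B⊆B′ (B′⊆A , B′-k2c))
    where
      Good : Subset N → Set
      Good B = (∀ x → x ∈ B → A x) × K2or2Conn G B

  block-absorbs : ∀ {X Y} → IsBlock G Y → TwoConnected (X ∪ Y) → 3 ≤ ∣ X ∪ Y ∣ → X ⊆ Y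
  block-absorbs {X} {Y} (_ , _ , maximal) (conn , conn-minus) 3≤∣X∪Y∣ x∈X =
    subst (_ ∈_) (maximal (X ∪ Y) (q⊆p∪q X Y) (λ _ _ → tt) (inj₂ (3≤∣X∪Y∣ , conn , conn-minus))) (p⊆p∪q Y x∈X)

  sequence⇒HasCycle : ∀ k (s : ℕ → V) → 3 ≤ k → (∀ i → suc i < k → Adj G (s i) (s (suc i))) →
    Adj G (s (k ∸ 1)) (s 0) → (∀ i j → i < k → j < k → s i ≡ s j → i ≡ j) → HasCycle G k
  sequence⇒HasCycle k s 3≤k s-adj s-close s-inj =
    (s ∘ toℕ) , 3≤k , (λ e → toℕ-injective (s-inj _ _ (toℕ<n _) (toℕ<n _) e)) , adj
    where
      adj : ∀ i j → suc (toℕ i) ≡ toℕ j ⊎ (suc (toℕ i) ≡ k × toℕ j ≡ 0) → Adj G (s (toℕ i)) (s (toℕ j))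
      adj i j (inj₁ 1+i≡j) = subst (λ b → Adj G (s (toℕ i)) (s b)) 1+i≡j (s-adj (toℕ i) (subst (_< k) (sym 1+i≡j) (toℕ<n j)))
      adj i j (inj₂ (1+i≡k , j≡0)) = subst₂ (λ a b → Adj G (s a) (s b)) (cong (_∸ 1) (sym 1+i≡k)) (sym j≡0) s-close

  -- A cycle of length L read as an L-periodic sequence, so that arcs may start at any index.
  record Cycle (L : ℕ) : Set where
    field
      vertex   : ℕ → V
      edge     : ∀ i → Adj G (vertex i) (vertex (suc i))
      periodic : ∀ i → vertex (L + i) ≡ vertex i
      distinct : ∀ {i j} → i < j → j < L + i → vertex i ≢ vertex j

  module _ {L : ℕ} (C : Cycle L) where
    open Cycle C

    ≢-ahead : ∀ p i → suc i < L → vertex p ≢ vertex (suc i + p)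
    ≢-ahead p i 1+i<L = distinct (s≤s (m≤n+m p i)) (+-monoˡ-< p 1+i<L)

    ≢-ahead′ : ∀ p i → suc i < L → vertex p ≢ vertex (i + suc p)
    ≢-ahead′ p i 1+i<L e = ≢-ahead p i 1+i<L (trans e (cong vertex (+-suc i p)))

    edge-to : ∀ {j} t → suc j ≡ L + t → Adj G (vertex j) (vertex t)
    edge-to {j} t 1+j≡L+t = subst (Adj G (vertex j)) (trans (cong vertex 1+j≡L+t) (periodic t)) (edge j)

    window-covers : ∀ t {v} → (∃[ i ] i < L × vertex i ≡ v) → ∃[ d ] d < L × vertex (d + t) ≡ v
    window-covers zero (i , i<L , e) = i , i<L , trans (cong vertex (+-identityʳ i)) e
    window-covers (suc t) v-on with window-covers t v-on
    ... | suc d , 1+d<L , e = d , <-trans (n<1+n d) 1+d<L , trans (cong vertex (+-suc d t)) e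
    ... | zero , 0<L , e = L ∸ 1 , subst (L ∸ 1 <_) 1+[L∸1]≡L (n<1+n (L ∸ 1)) ,
                           trans (cong vertex (trans (+-suc (L ∸ 1) t) (cong (_+ t) 1+[L∸1]≡L))) (trans (periodic t) e)
      where
        1+[L∸1]≡L : suc (L ∸ 1) ≡ L
        1+[L∸1]≡L = m+[n∸m]≡n 0<L

    arc : ∀ {P : V → Set} a k → (∀ e → e ≤ k → P (vertex (e + a))) → Walk P (vertex a) (vertex (k + a))
    arc a zero on = [ on 0 z≤n ]
    arc a (suc k) on =
      arc a k (λ e e≤k → on e (m≤n⇒m≤1+n e≤k)) ++ (on k (n≤1+n k) ∷⟨ edge (k + a) ⟩ [ on (suc k) ≤-refl ])

    TwoConnected-cycle : ∀ (S : Subset N) → 3 ≤ L → (∀ i → vertex i ∈ S) →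
      (∀ {v} → v ∈ S → ∃[ i ] i < L × vertex i ≡ v) → TwoConnected S
    TwoConnected-cycle S 3≤L on-S S-on = connected-via (vertex 0) (on-S 0) to-origin , minus
      where
        to-origin : ∀ v → v ∈ S → Walk (_∈ S) v (vertex 0)
        to-origin v v∈S with window-covers 0 (S-on v∈S)
        ... | d , _ , refl = reverse (arc 0 d (λ e _ → on-S (e + 0)))
        minus : ∀ z → z ∈ S → ConnectedIn G (_∈ S - z)
        minus z z∈S with S-on z∈S
        ... | t , _ , refl = connected-via (vertex (suc t)) (ahead∈ 0 (≤-trans (s≤s (s≤s z≤n)) 3≤L)) to-next
          where
            ahead∈ : ∀ e → suc e < L → vertex (e + suc t) ∈ S - vertex t
            ahead∈ e 1+e<L = x∈p∧x≢y⇒x∈p-y (on-S _) (≢-ahead′ t e 1+e<L ∘ sym)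
            to-next : ∀ v → v ∈ S - vertex t → Walk (_∈ S - vertex t) v (vertex (suc t))
            to-next v v∈ with window-covers t (S-on (x∈p-y⇒x∈p v∈))
            ... | zero , _ , refl = contradiction refl (x∈p-y⇒x≢y v∈)
            ... | suc d , 1+d<L , refl = subst (λ x → Walk (_∈ S - vertex t) x (vertex (suc t))) (cong vertex (+-suc d t))
                  (reverse (arc (suc t) d (λ e e≤d → ahead∈ e (≤-<-trans (s≤s e≤d) 1+d<L))))

    fan : ∀ r m a → 1 ≤ m → m < L → (∀ i → i ≤ m → vertex (i + a) ≢ r) →
      Adj G r (vertex a) → Adj G r (vertex (m + a)) → HasCycle G (2 + m)
    fan r m a 1≤m m<L off r~first r~last = sequence⇒HasCycle (2 + m) s (s≤s (s≤s 1≤m)) s-adj (Adj-sym r~last) s-inj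
      where
        s : ℕ → V
        s zero = r
        s (suc i) = vertex (i + a)
        s-adj : ∀ i → suc i < 2 + m → Adj G (s i) (s (suc i))
        s-adj zero _ = r~first
        s-adj (suc i) _ = edge (i + a)
        window-inj : ∀ {i j} → i < j → j ≤ m → vertex (i + a) ≢ vertex (j + a)
        window-inj {i} {j} i<j j≤m =
          distinct (+-monoˡ-< a i<j) (<-≤-trans (+-monoˡ-< a (≤-<-trans j≤m m<L)) (+-monoʳ-≤ L (m≤n+m a i)))
        s-inj : ∀ i j → i < 2 + m → j < 2 + m → s i ≡ s j → i ≡ j
        s-inj zero zero _ _ _ = refl
        s-inj zero (suc j) _ (s≤s j≤m) e = contradiction (sym e) (off j (m<1+n⇒m≤n j≤m))
        s-inj (suc i) zero (s≤s i≤m) _ e = contradiction e (off i (m<1+n⇒m≤n i≤m))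
        s-inj (suc i) (suc j) (s≤s i<1+m) (s≤s j<1+m) e with <-cmp i j
        ... | tri< i<j _ _ = contradiction e (window-inj i<j (m<1+n⇒m≤n j<1+m))
        ... | tri≈ _ i≡j _ = cong suc i≡j
        ... | tri> _ _ j<i = contradiction (sym e) (window-inj j<i (m<1+n⇒m≤n i<1+m))

    apex-off-cycle : ∀ m r u → 1 ≤ m → 2 + m ≤ L → (∀ j → vertex j ≢ r) → Dec (∃[ p ] vertex p ≡ u) →
      (∀ j → vertex j ≢ u → Adj G r (vertex j)) → HasCycle G (2 + m)
    apex-off-cycle m r u 1≤m 2+m≤L off (no u-off) dom =
      fan r m 0 1≤m 2+m≤L′ (λ i _ → off (i + 0)) (dom 0 (u-off ∘ (0 ,_))) (dom (m + 0) (u-off ∘ (m + 0 ,_)))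
      where 2+m≤L′ = ≤-trans (n≤1+n (suc m)) 2+m≤L
    apex-off-cycle m r u 1≤m 2+m≤L off (yes (p , refl)) dom =
      fan r m (suc p) 1≤m (≤-trans (n≤1+n (suc m)) 2+m≤L) (λ i _ → off (i + suc p))
        (dom (suc p) (≢-ahead p 0 (≤-trans (s≤s (s≤s z≤n)) 2+m≤L) ∘ sym)) (dom (m + suc p) (≢-ahead′ p m 2+m≤L ∘ sym))

    apex-on-cycle : ∀ m t u → 2 ≤ m → 2 + m ≤ L →
      (∀ j → vertex j ≢ vertex t → vertex j ≢ u → Adj G (vertex t) (vertex j)) → HasCycle G (2 + m)
    apex-on-cycle m t u 2≤m 2+m≤L dom = choose (2 + m ≟ L) (vertex (m + suc t) ≟F u)
      where
        1≤m = ≤-trans (n≤1+n 1) 2≤m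
        m<L = ≤-trans (n≤1+n (suc m)) 2+m≤L
        off : ∀ i → i ≤ m → vertex (i + suc t) ≢ vertex t
        off i i≤m = ≢-ahead′ t i (≤-trans (s≤s (s≤s i≤m)) 2+m≤L) ∘ sym
        -- When the window after the apex ends at u, shifting it by one avoids u.
        choose : Dec (2 + m ≡ L) → Dec (vertex (m + suc t) ≡ u) → HasCycle G (2 + m)
        choose (yes 2+m≡L) _ =
          fan (vertex t) m (suc t) 1≤m m<L off (edge t) (Adj-sym (edge-to t (trans (cong suc (+-suc m t)) (cong (_+ t) 2+m≡L))))
        choose (no _) (no last≢u) = fan (vertex t) m (suc t) 1≤m m<L off (edge t) (dom (m + suc t) (off m ≤-refl) last≢u)
        choose (no 2+m≢L) (yes last≡u) =
          fan (vertex t) m (suc (suc t)) 1≤m m<L off₂ (dom (suc (suc t)) (≢-ahead t 1 2<L ∘ sym) first≢u) last~apex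
          where
            2+m<L = ≤∧≢⇒< 2+m≤L 2+m≢L
            2<L = ≤-trans (s≤s (s≤s 1≤m)) 2+m≤L
            off₂ : ∀ i → i ≤ m → vertex (i + suc (suc t)) ≢ vertex t
            off₂ i i≤m e = ≢-ahead′ t (suc i) (≤-trans (s≤s (s≤s (s≤s i≤m))) 2+m<L) (trans (sym e) (cong vertex (+-suc i (suc t))))
            first≢u : vertex (suc (suc t)) ≢ u
            first≢u e = distinct (subst (suc (suc t) <_) (sym (+-suc m t)) (s≤s (+-monoˡ-≤ t 2≤m)))
                                 (≤-trans (+-monoˡ-< (suc t) m<L) (+-monoʳ-≤ L (n≤1+n (suc t)))) (trans e (sym last≡u))
            last~apex : Adj G (vertex t) (vertex (m + suc (suc t)))
            last~apex with 3 + m ≟ L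
            ... | yes 3+m≡L = Adj-sym (edge-to t (trans (cong suc (trans (+-suc m (suc t)) (cong suc (+-suc m t)))) (cong (_+ t) 3+m≡L)))
            ... | no _ = dom _ (off₂ m ≤-refl) λ e → ≢-ahead (m + suc t) 0 (≤-trans (s≤s (s≤s z≤n)) 2+m≤L)
                                                     (trans last≡u (trans (sym e) (cong vertex (+-suc m (suc t)))))

    dominated⇒HasCycle : ∀ m r u → 2 ≤ m → 2 + m ≤ L → Dec (∃[ t ] vertex t ≡ r) → Dec (∃[ p ] vertex p ≡ u) →
      (∀ j → vertex j ≢ r → vertex j ≢ u → Adj G r (vertex j)) → HasCycle G (2 + m)
    dominated⇒HasCycle m r u 2≤m 2+m≤L (yes (t , refl)) _ dom = apex-on-cycle m t u 2≤m 2+m≤L dom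
    dominated⇒HasCycle m r u 2≤m 2+m≤L (no r-off) u? dom =
      apex-off-cycle m r u (≤-trans (n≤1+n 1) 2≤m) 2+m≤L (λ j e → r-off (j , e)) u? (λ j → dom j (λ e → r-off (j , e)))

  module CycleOf {L′ : ℕ} (hc : HasCycle G (suc L′)) where
    private
      L = suc L′
      c = proj₁ hc
      c-injective = proj₁ (proj₂ (proj₂ hc))
      c-adj = proj₂ (proj₂ (proj₂ hc))

    index : ℕ → Fin L
    index j = fromℕ< (m%n<n j L)

    toℕ-index : ∀ j → toℕ (index j) ≡ j % L
    toℕ-index j = toℕ-fromℕ< (m%n<n j L)

    cycle : Cycle L
    cycle = record { vertex = c ∘ index ; edge = edge ; periodic = periodic ; distinct = distinct }
      where
        step : ∀ j → suc (toℕ (index j)) ≡ toℕ (index (suc j)) ⊎ (suc (toℕ (index j)) ≡ L × toℕ (index (suc j)) ≡ 0)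
        step j rewrite toℕ-index j | toℕ-index (suc j) = [1+m]%n≡1+[m%n]⊎1+[m%n]≡n j L
        edge : ∀ j → Adj G (c (index j)) (c (index (suc j)))
        edge j = c-adj (index j) (index (suc j)) (step j)
        periodic : ∀ j → c (index (L + j)) ≡ c (index j)
        periodic j = cong c (toℕ-injective (begin
          toℕ (index (L + j)) ≡⟨ toℕ-index (L + j) ⟩
          (L + j) % L         ≡⟨ cong (_% L) (+-comm L j) ⟩
          (j + L) % L         ≡⟨ [m+n]%n≡m%n j L ⟩
          j % L               ≡⟨ toℕ-index j ⟨
          toℕ (index j)       ∎))
          where open ≡-Reasoning
        distinct : ∀ {i j} → i < j → j < L + i → c (index i) ≢ c (index j)
        distinct {i} {j} i<j j<L+i e = [d+i]%n≢i%n (j ∸ i) i L (m<n⇒0<n∸m i<j)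
          (subst (j ∸ i <_) (m+n∸n≡m L i) (∸-monoˡ-< j<L+i (<⇒≤ i<j))) (begin
            (j ∸ i + i) % L     ≡⟨ cong (_% L) (m∸n+n≡m (<⇒≤ i<j)) ⟩
            j % L               ≡⟨ toℕ-index j ⟨
            toℕ (index j)       ≡⟨ cong toℕ (c-injective e) ⟨
            toℕ (index i)       ≡⟨ toℕ-index i ⟩
            i % L               ∎)
          where open ≡-Reasoning

    open Cycle cycle public using (vertex)

    vertex-toℕ : ∀ i → vertex (toℕ i) ≡ c i
    vertex-toℕ i = cong c (toℕ-injective (trans (toℕ-index (toℕ i)) (m<n⇒m%n≡m (toℕ<n i))))

    vertices : Subset N
    vertices = toSubset (λ v → any? (λ i → c i ≟F v))

    vertex∈vertices : ∀ j → vertex j ∈ vertices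
    vertex∈vertices j = ∈-toSubset⁺ (λ v → any? (λ i → c i ≟F v)) (index j , refl)

    vertices-on-cycle : ∀ {v} → v ∈ vertices → ∃[ i ] i < L × vertex i ≡ v
    vertices-on-cycle v∈ with ∈-toSubset⁻ (λ v → any? (λ i → c i ≟F v)) v∈
    ... | i , e = toℕ i , toℕ<n i , trans (vertex-toℕ i) e

    on-cycle? : ∀ v → Dec (∃[ t ] vertex t ≡ v)
    on-cycle? v = map′ (λ (i , e) → toℕ i , trans (vertex-toℕ i) e) (λ (t , e) → index t , e) (any? (λ i → c i ≟F v))

  DominatedExceptOne : V → Subset N → Set
  DominatedExceptOne h B = ∃[ u ] (∀ w → w ∈ B → w ≢ h → w ≢ u → Adj G h w)

  degree-one⇒≡ : ∀ {w p q} → Degree1In G (Everywhere G) w → Adj G w p → Adj G w q → p ≡ q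
  degree-one⇒≡ (_ , _ , _ , unique) w~p w~q = trans (unique _ tt w~p) (sym (unique _ tt w~q))

  -- A vertex of H with two distinct neighbours is not the handle of an umbrella.
  InH⇒dominated-block : ∀ k h {x p q} → x ≢ h → p ≢ q → Adj G x p → Adj G x q → InH G k h x →
    ∃[ B ] (IsBlock G B × x ∈ B × h ∈ B × DominatedExceptOne h B)
  InH⇒dominated-block k h x≢h _ _ _ (inj₁ x≡h) = contradiction x≡h x≢h
  InH⇒dominated-block k h _ _ _ _ (inj₂ (B , x∈B , inj₁ (B-block , h∈B , u , _ , _ , _ , only-u))) =
    B , B-block , x∈B , h∈B , u , λ w w∈B w≢h w≢u →
      decidable-stable (Graph.E G h w ≟B true) (w≢u ∘ only-u w w∈B w≢h)
  InH⇒dominated-block k h _ _ _ _ (inj₂ (B , x∈B , inj₂ (_ , inj₁ (_ , (B-block , _ , h∈B , dom , _) , _)))) =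
    B , B-block , x∈B , h∈B , h , λ w w∈B w≢h _ → dom w w∈B w≢h
  InH⇒dominated-block k h {x} _ p≢q x~p x~q
    (inj₂ (B , x∈B , inj₂ (B₁ , inj₂ (_ , (B₁-block , _ , h∈B₁ , dom , _ , _ , _ , _ , _ , _ , handle) , _)))) with x ∈? B₁
  ... | yes x∈B₁ = B₁ , B₁-block , x∈B₁ , h∈B₁ , h , λ w w∈B₁ w≢h _ → dom w w∈B₁ w≢h
  ... | no x∉B₁ = contradiction (degree-one⇒≡ (handle x x∈B x∉B₁) x~p x~q) p≢q

  block-TwoConnected : ∀ {A B} → IsBlockIn G A B → TwoConnected B
  block-TwoConnected (_ , k2c , _) = K2or2Conn⇒TwoConnected k2c

  -- Bx ∪ By is 2-connected, so its union with B is too; maximality of B then puts h into B,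
  -- and maximality of Bx absorbs B.
  block⊆block-through-edge : ∀ {B Bx By x y h} → IsBlock G B → IsBlock G Bx → IsBlock G By →
    x ∈ B → y ∈ B → x ∈ Bx → h ∈ Bx → y ∈ By → h ∈ By → Adj G x y → x ≢ h → y ≢ h → B ⊆ Bx
  block⊆block-through-edge {B} {Bx} {By} {x} {y} {h} B-block Bx-block By-block x∈B y∈B x∈Bx h∈Bx y∈By h∈By x~y x≢h y≢h =
    block-absorbs Bx-block (∪-TwoConnected-sharing₂ cB cBx h≢x h∈B h∈Bx x∈B x∈Bx)
      (distinct₃⇒3≤∣p∣ (p⊆p∪q Bx h∈B) (p⊆p∪q Bx x∈B) (p⊆p∪q Bx y∈B) h≢x h≢y x≢y)
    where
      x≢y = Adj⇒≢ x~y
      h≢x = x≢h ∘ sym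
      h≢y = y≢h ∘ sym
      cB = block-TwoConnected B-block
      cBx = block-TwoConnected Bx-block
      cD = ∪-TwoConnected-sharing-edge cBx (block-TwoConnected By-block) h∈Bx h∈By x∈Bx y∈By x~y x≢h y≢h
      h∈D = p⊆p∪q By h∈Bx
      x∈D = p⊆p∪q By x∈Bx
      y∈D = q⊆p∪q Bx By y∈By
      h∈B : h ∈ B
      h∈B = block-absorbs B-block (∪-TwoConnected-sharing₂ cD cB x≢y x∈D x∈B y∈D y∈B)
              (distinct₃⇒3≤∣p∣ (p⊆p∪q B h∈D) (p⊆p∪q B x∈D) (p⊆p∪q B y∈D) h≢x h≢y x≢y) h∈D

  cycle-block⊆dominated-block : ∀ k h {L} (C : Cycle L) → 3 ≤ L → Dec (∃[ t ] Cycle.vertex C t ≡ h) →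
    ∀ {B} → IsBlock G B → (∀ i → Cycle.vertex C i ∈ B) → (∀ {y} → y ∈ B → ¬ ¬ InH G k h y) →
    ¬ ¬ (∃[ X ] (B ⊆ X × DominatedExceptOne h X))
  cycle-block⊆dominated-block k h C 3≤L h-on? {B} B-block C⊆B B⊆H found = consecutive-avoiding h-on?
    where
      open Cycle C
      ≢-next₂ : ∀ i → vertex i ≢ vertex (suc (suc i))
      ≢-next₂ i = ≢-ahead C i 1 3≤L
      from : ∃[ b ] (vertex (suc b) ≢ h × vertex (suc (suc b)) ≢ h) → ⊥
      from (b , x≢h , y≢h) = B⊆H (C⊆B (suc b)) λ x∈H → B⊆H (C⊆B (suc (suc b))) λ y∈H →
        let (Bx , Bx-block , x∈Bx , h∈Bx , Bx-dom) =
              InH⇒dominated-block k h x≢h (≢-next₂ b) (Adj-sym (edge b)) (edge (suc b)) x∈H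
            (By , By-block , y∈By , h∈By , _) =
              InH⇒dominated-block k h y≢h (≢-next₂ (suc b)) (Adj-sym (edge (suc b))) (edge (suc (suc b))) y∈H
        in found (Bx , block⊆block-through-edge B-block Bx-block By-block (C⊆B (suc b)) (C⊆B (suc (suc b)))
                         x∈Bx h∈Bx y∈By h∈By (edge (suc b)) x≢h y≢h , Bx-dom)
      consecutive-avoiding : Dec (∃[ t ] vertex t ≡ h) → ⊥
      consecutive-avoiding (yes (t , refl)) = from (t , ≢-ahead C t 0 (≤-trans (n≤1+n 2) 3≤L) ∘ sym , ≢-next₂ t ∘ sym)
      consecutive-avoiding (no h-off) = from (0 , (λ e → h-off (1 , e)) , (λ e → h-off (2 , e)))

  no-longer-cycle : ∀ m h → 2 ≤ m → (∀ B → IsBlockIn G (InF G (2 + m) h) B → Rooted G (2 + m) h B) →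
    ¬ HasCycle G (2 + m) → ∀ ℓ → 2 + m ≤ ℓ → ¬ HasCycle G ℓ
  no-longer-cycle m h 2≤m F-rooted no-k-cycle (suc L′) 2+m≤ℓ hc =
    ¬¬-excluded-middle λ
      { (yes S⊆F) → ¬¬-block-containing S S⊆F S-k2c λ (B , S⊆B , B-block) →
          let (r , _ , r-dom , _) = F-rooted B B-block in no-dominating-vertex S⊆B (r , λ w w∈B w≢r _ → r-dom w w∈B w≢r)
      ; (no S⊈F) → ¬¬-block-containing S (λ _ _ → tt) S-k2c λ (B , S⊆B , B-block) →
          cycle-block⊆dominated-block (2 + m) h cycle 3≤ℓ (on-cycle? h) B-block (S⊆B ∘ vertex∈vertices)
            (λ {y} y∈B ¬InH → S⊈F λ v v∈S → inj₂ (B , B-block , S⊆B v∈S , λ B⊆H → ¬InH (B⊆H y y∈B)))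
            λ (X , B⊆X , X-dom) → no-dominating-vertex (B⊆X ∘ S⊆B) X-dom }
    where
      open CycleOf hc
      S = vertices
      3≤ℓ = ≤-trans (s≤s (s≤s (≤-trans (n≤1+n 1) 2≤m))) 2+m≤ℓ
      S-k2c : K2or2Conn G S
      S-k2c = inj₂ (distinct₃⇒3≤∣p∣ (vertex∈vertices 0) (vertex∈vertices 1) (vertex∈vertices 2)
                      (≢-ahead cycle 0 0 (≤-trans (n≤1+n 2) 3≤ℓ)) (≢-ahead cycle 0 1 3≤ℓ) (≢-ahead cycle 1 0 (≤-trans (n≤1+n 2) 3≤ℓ)) ,
                    TwoConnected-cycle cycle S 3≤ℓ vertex∈vertices vertices-on-cycle)
      no-dominating-vertex : ∀ {X r} → S ⊆ X → DominatedExceptOne r X → ⊥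
      no-dominating-vertex {r = r} S⊆X (u , dom) =
        no-k-cycle (dominated⇒HasCycle cycle m r u 2≤m 2+m≤ℓ (on-cycle? r) (on-cycle? u) λ j → dom (vertex j) (S⊆X (vertex∈vertices j)))

lemma3p4 : (k : ℕ) → 5 ≤ k → (𝒞 : CycleFamily) → KDense k 𝒞 →
    (G : Graph) → CFree G 𝒞 → (h : Vertex G) → Fantastic G k h →
    CircumferenceAtMost G (k ∸ 1)
lemma3p4 (suc (suc m)) (s≤s (s≤s 3≤m)) 𝒞 ((𝒞k , _) , _) G 𝒞-free h (_ , F-rooted , _) ℓ hc with ℓ ≤? suc m
... | yes ℓ≤k-1 = ℓ≤k-1
... | no ℓ≰k-1 = contradiction hc (no-longer-cycle G m h (≤-trans (n≤1+n 2) 3≤m) F-rooted (𝒞-free _ 𝒞k) ℓ (≰⇒> ℓ≰k-1))
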